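{- Let $G$ be a graph, $v\in V(G)$, and $r$ a positive integer. Suppose $G[N_G^{\le r}(v)]$ contains an odd cycle $C$. Then $G[N_G^{\le r}(v)]$ contains an odd cycle of length at most $2r+1$. Furthermore, if $N_G^{=r}(v)\cap V(C)$ is an independent set of $G$, then $G[N_G^{\le r-1}(v)]$ contains an odd cycle of length at most $2r-1$.
   Context: For a graph $G$, a vertex $v$ and an integer $r\ge 0$, $N_G^{\le r}(v)$ (resp. $N_G^{=r}(v)$) denotes the set of vertices of $G$ at distance at most $r$ (resp. exactly $r$) from $v$ in $G$; $G[S]$ denotes the subgraph induced by $S$. -}

module Defs where

open import Data.Nat using (ℕ; zero; suc; _+_; _*_; _≤_; _<_)
open import Data.Fin using (Fin; toℕ)
open import Data.Product using (Σ; ∃; _×_; _,_)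
open import Relation.Nullary using (¬_)
open import Relation.Binary.PropositionalEquality using (_≡_)
open import Relation.Binary.Definitions using (Decidable)
open import Function.Definitions using (Injective)

record Graph (n : ℕ) : Set₁ where
  field
    Adj     : Fin n → Fin n → Set
    adj?    : Decidable Adj
    sym     : ∀ {x y} → Adj x y → Adj y x
    irrefl  : ∀ {x} → ¬ Adj x x
open Graph public

data Walk {n : ℕ} (G : Graph n) : Fin n → Fin n → ℕ → Set where
  here : ∀ {x} → Walk G x x 0
  step : ∀ {x y z k} → Adj G x y → Walk G y z k → Walk G x z (suc k)

DistLe : ∀ {n} → Graph n → Fin n → Fin n → ℕ → Set
DistLe G v u r = ∃ λ k → k ≤ r × Walk G v u k

DistEq : ∀ {n} → Graph n → Fin n → Fin n → ℕ → Set
DistEq G v u r = DistLe G v u r × (∀ k → k < r → ¬ Walk G v u k)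

InBall : ∀ {n} → Graph n → Fin n → ℕ → Fin n → Set
InBall G v r u = DistLe G v u r

InSphere : ∀ {n} → Graph n → Fin n → ℕ → Fin n → Set
InSphere G v r u = DistEq G v u r

record Cycle {n : ℕ} (G : Graph n) (k : ℕ) : Set where
  field
    k≥3   : 3 ≤ k
    vert  : Fin k → Fin n
    inj   : Injective _≡_ _≡_ vert
    adj   : ∀ (i j : Fin k) → toℕ j ≡ suc (toℕ i) → Adj G (vert i) (vert j)
    wrap  : ∀ (i j : Fin k) → suc (toℕ i) ≡ k → toℕ j ≡ 0 → Adj G (vert i) (vert j)
open Cycle public

Odd : ℕ → Set
Odd k = ∃ λ m → k ≡ 2 * m + 1

-- The cycle C lies in the induced subgraph G[S] (S given as a predicate):
-- all its vertices are in S (its edges are then edges of G[S]).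
CycleIn : ∀ {n k} {G : Graph n} → (Fin n → Set) → Cycle G k → Set
CycleIn S C = ∀ i → S (vert C i)

HasShortOddCycleIn : ∀ {n} → (G : Graph n) → (Fin n → Set) → ℕ → Set
HasShortOddCycleIn G S L = Σ ℕ λ k → Σ (Cycle G k) λ C → Odd k × k ≤ L × CycleIn S C

SphereCycleIndependent : ∀ {n k} (G : Graph n) → Fin n → ℕ → Cycle G k → Set
SphereCycleIndependent G v r C =
  ∀ (i j : Fin _) → InSphere G v r (vert C i) → InSphere G v r (vert C j) →
    ¬ Adj G (vert C i) (vert C j)

{-# OPTIONS --safe #-}
-- Along an odd closed walk in the ball, the distance from v changes by at most one per edge and
-- returns to its initial value, so by parity some edge xy has both ends at the same distance d ≤ r.
-- Shortest walks from v to x and to y, joined by xy, form a closed walk of length 2d + 1 inside the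
-- ball of radius d, and every odd closed walk contains an odd cycle on its vertices that is no
-- longer than the walk. If the vertices of C at distance r are independent, xy cannot lie in the
-- sphere, so d ≤ r - 1.
module Submission where

open import Defs hiding (sym)
open import Data.Nat
  using (ℕ; zero; suc; _+_; _*_; _∸_; _≤_; _<_; z≤n; s≤s; _≤?_; parity; NonZero; >-nonZero)
open import Data.Nat.Properties
open import Data.Nat.DivMod using (_mod_; _%_; m%n<n; n%n≡0; m<n⇒m%n≡m)
open import Data.Nat.Induction using (<-rec)
open import Data.Nat.Tactic.RingSolver using (solve)
open import Data.Parity.Base as ℙ using (0ℙ; 1ℙ; _⁻¹)
open import Data.Parity.Properties using (+-homo-+; *-homo-*; p≢p⁻¹)
open import Data.Fin using (Fin; toℕ)
open import Data.Fin.Properties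
  using (any?; toℕ-injective; toℕ<n; toℕ-fromℕ<) renaming (_≟_ to _≟ᶠ_)
open import Data.List using (_∷_; [])
open import Data.Product using (Σ; ∃; _×_; _,_; proj₁; proj₂)
open import Data.Sum using (_⊎_; inj₁; inj₂)
open import Data.Empty using (⊥-elim)
open import Function using (_∘_; id)
open import Relation.Nullary using (¬_; Dec; yes; no; contradiction)
open import Relation.Nullary.Decidable using (_×-dec_)
import Relation.Unary as U
open import Relation.Binary using (tri<; tri≈; tri>)
open import Relation.Binary.PropositionalEquality

minimal-witness : ∀ {p} {P : U.Pred ℕ p} → U.Decidable P → ∀ {k} → P k →
                  ∃ λ m → P m × (∀ j → j < m → ¬ P j)
minimal-witness {p} {P} P? {k} = <-rec (λ k → P k → Minimal) search k
  where
  Minimal : Set p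
  Minimal = ∃ λ m → P m × (∀ j → j < m → ¬ P j)
  search : ∀ k → (∀ {j} → j < k → P j → Minimal) → P k → Minimal
  search k smaller pk with anyUpTo? P? k
  ... | yes (j , j<k , pj) = smaller j<k pj
  ... | no none            = k , pk , λ j j<k pj → none (j , j<k , pj)

Odd⇒parity≡1ℙ : ∀ {m} → Odd m → parity m ≡ 1ℙ
Odd⇒parity≡1ℙ (m , refl) = trans (+-homo-+ (2 * m) 1) (cong (ℙ._+ 1ℙ) (*-homo-* 2 m))

parity≡1ℙ⇒Odd : ∀ m → parity m ≡ 1ℙ → Odd m
parity≡1ℙ⇒Odd 1             _ = 0 , refl
parity≡1ℙ⇒Odd (suc (suc m)) p with parity≡1ℙ⇒Odd m p
... | k , refl = suc k , solve (k ∷ [])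

Odd-+ : ∀ m n → Odd (m + n) → Odd m ⊎ Odd n
Odd-+ m n o with parity m in eq
... | 1ℙ = inj₁ (parity≡1ℙ⇒Odd m eq)
... | 0ℙ = inj₂ (parity≡1ℙ⇒Odd n (begin
  parity n                  ≡⟨ cong (ℙ._+ parity n) eq ⟨
  parity m ℙ.+ parity n     ≡⟨ +-homo-+ m n ⟨
  parity (m + n)            ≡⟨ Odd⇒parity≡1ℙ o ⟩
  1ℙ                        ∎))
  where open ≡-Reasoning

parity-step : ∀ i {a b} → a ≤ suc b → b ≤ suc a → a ≢ b → parity (suc i + b) ≡ parity (i + a)
parity-step i {a} {b} a≤1+b b≤1+a a≢b with <-cmp a b
... | tri< a<b _ _ rewrite ≤-antisym b≤1+a a<b = cong (parity ∘ suc) (+-suc i a)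
... | tri≈ _ a≡b _ = contradiction a≡b a≢b
... | tri> _ _ b<a rewrite ≤-antisym a≤1+b b<a = sym (cong parity (+-suc i b))

-- Without a level step, i + h i would keep its parity, contradicting h L ≡ h 0 for odd L.
lipschitz-odd-loop⇒level-step : ∀ {L} (h : ℕ → ℕ) → Odd L → h L ≡ h 0 →
  (∀ {i} → i < L → h (suc i) ≤ suc (h i) × h i ≤ suc (h (suc i))) →
  ∃ λ i → i < L × h i ≡ h (suc i)
lipschitz-odd-loop⇒level-step {L} h o loop lipschitz with anyUpTo? (λ i → h i ≟ h (suc i)) L
... | yes level = level
... | no none   = ⊥-elim (p≢p⁻¹ (parity (h 0)) p≡p⁻¹)
  where
  open ≡-Reasoning
  invariant : ∀ i → i ≤ L → parity (i + h i) ≡ parity (h 0)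
  invariant zero    _   = refl
  invariant (suc i) i<L = trans
    (parity-step i (proj₂ (lipschitz i<L)) (proj₁ (lipschitz i<L)) (λ eq → none (i , i<L , eq)))
    (invariant i (<⇒≤ i<L))
  p≡p⁻¹ : parity (h 0) ≡ parity (h 0) ⁻¹
  p≡p⁻¹ = begin
    parity (h 0)              ≡⟨ invariant L ≤-refl ⟨
    parity (L + h L)          ≡⟨ +-homo-+ L (h L) ⟩
    parity L ℙ.+ parity (h L) ≡⟨ cong₂ ℙ._+_ (Odd⇒parity≡1ℙ o) (cong parity loop) ⟩
    parity (h 0) ⁻¹           ∎

module _ {n : ℕ} (G : Graph n) where

  snoc : ∀ {x y z k} → Walk G x y k → Adj G y z → Walk G x z (suc k)
  snoc here       a = step a here
  snoc (step b w) a = step b (snoc w a)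

  reverse : ∀ {x y k} → Walk G x y k → Walk G y x k
  reverse here       = here
  reverse (step a w) = snoc (reverse w) (Graph.sym G a)

  _++_ : ∀ {x y z k l} → Walk G x y k → Walk G y z l → Walk G x z (k + l)
  here     ++ q = q
  step a p ++ q = step a (p ++ q)

  at : ∀ {x y k} → Walk G x y k → ℕ → Fin n
  at {x} here       _       = x
  at {x} (step _ _) zero    = x
  at     (step _ w) (suc i) = at w i

  at-start : ∀ {x y k} (w : Walk G x y k) → at w 0 ≡ x
  at-start here       = refl
  at-start (step _ _) = refl

  at-end : ∀ {x y k} (w : Walk G x y k) → at w k ≡ y
  at-end here       = refl
  at-end (step _ w) = at-end w

  at-edge : ∀ {x y k} (w : Walk G x y k) {i} → i < k → Adj G (at w i) (at w (suc i))
  at-edge (step a w) {zero}  _         rewrite at-start w = a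
  at-edge (step _ w) {suc i} (s≤s i<k) = at-edge w i<k

  All : ∀ {x y k} → (Fin n → Set) → Walk G x y k → Set
  All P (here {x})     = P x
  All P (step {x} _ w) = P x × All P w

  All-map : ∀ {P Q : Fin n → Set} → (∀ {u} → P u → Q u) →
            ∀ {x y k} (w : Walk G x y k) → All P w → All Q w
  All-map f here       px        = f px
  All-map f (step _ w) (px , pw) = f px , All-map f w pw

  All-snoc : ∀ {P x y z k} (w : Walk G x y k) (a : Adj G y z) → All P w → P z → All P (snoc w a)
  All-snoc here       _ px        pz = px , pz
  All-snoc (step _ w) a (px , pw) pz = px , All-snoc w a pw pz

  All-reverse : ∀ {P x y k} (w : Walk G x y k) → All P w → All P (reverse w)
  All-reverse here       px        = px
  All-reverse (step a w) (px , pw) = All-snoc (reverse w) _ (All-reverse w pw) px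

  All-++ : ∀ {P x y z k l} (p : Walk G x y k) (q : Walk G y z l) →
           All P p → All P q → All P (p ++ q)
  All-++ here       _ _         pq = pq
  All-++ (step _ p) q (px , pp) pq = px , All-++ p q pp pq

  All-at : ∀ {P x y k} (w : Walk G x y k) → All P w → ∀ i → P (at w i)
  All-at here       px        _       = px
  All-at (step _ _) (px , _)  zero    = px
  All-at (step _ w) (_  , pw) (suc i) = All-at w pw i

  All-DistLe : ∀ {x y k} (w : Walk G x y k) → All (λ u → DistLe G x u k) w
  All-DistLe here       = 0 , z≤n , here
  All-DistLe (step a w) =
    (0 , z≤n , here) ,
    All-map (λ { (j , j≤k , w′) → suc j , s≤s j≤k , step a w′ }) w (All-DistLe w)

  walk? : ∀ x y k → Dec (Walk G x y k)
  walk? x y zero with x ≟ᶠ y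
  ... | yes refl = yes here
  ... | no x≢y   = no λ { here → x≢y refl }
  walk? x y (suc k) with any? (λ z → adj? G x z ×-dec walk? z y k)
  ... | yes (_ , a , w) = yes (step a w)
  ... | no ∄            = no λ { (step a w) → ∄ (_ , a , w) }

  InBall-mono : ∀ {v r s} → r ≤ s → ∀ {u} → InBall G v r u → InBall G v s u
  InBall-mono r≤s (k , k≤r , w) = k , ≤-trans k≤r r≤s , w

  DistEq⇒Walk : ∀ {v u d} → DistEq G v u d → Walk G v u d
  DistEq⇒Walk ((k , k≤d , w) , shortest) with m≤n⇒m<n∨m≡n k≤d
  ... | inj₁ k<d  = contradiction w (shortest k k<d)
  ... | inj₂ refl = w

  distance : ∀ {v u r} → DistLe G v u r → ∃ λ d → d ≤ r × DistEq G v u d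
  distance {v} {u} (k , k≤r , w) with minimal-witness (walk? v u) w
  ... | d , wd , shortest =
    d , ≤-trans (≮⇒≥ λ k<d → shortest k k<d w) k≤r , (d , ≤-refl , wd) , shortest

  DistEq-unique : ∀ {v u d d′} → DistEq G v u d → DistEq G v u d′ → d ≡ d′
  DistEq-unique dd dd′ = ≤-antisym
    (≮⇒≥ λ d′<d → proj₂ dd _ d′<d (DistEq⇒Walk dd′))
    (≮⇒≥ λ d<d′ → proj₂ dd′ _ d<d′ (DistEq⇒Walk dd))

  DistEq-edge : ∀ {v x y d d′} → Adj G x y → DistEq G v x d → DistEq G v y d′ → d′ ≤ suc d
  DistEq-edge a dx dy = ≮⇒≥ λ lt → proj₂ dy _ lt (snoc (DistEq⇒Walk dx) a)

  HasShortOddCycleIn-mono : ∀ {S T : Fin n → Set} {L L′} → (∀ {u} → S u → T u) → L ≤ L′ →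
                            HasShortOddCycleIn G S L → HasShortOddCycleIn G T L′
  HasShortOddCycleIn-mono S⊆T L≤L′ (k , C , o , k≤L , inS) =
    k , C , o , ≤-trans k≤L L≤L′ , S⊆T ∘ inS

  -- Positions beyond L carry no information; `closed` identifies position L with 0.
  record ClosedWalk (L : ℕ) : Set where
    field
      vertex : ℕ → Fin n
      edge   : ∀ {i} → i < L → Adj G (vertex i) (vertex (suc i))
      closed : vertex L ≡ vertex 0
  open ClosedWalk

  Walk⇒ClosedWalk : ∀ {x L} → Walk G x x L → ClosedWalk L
  Walk⇒ClosedWalk w = record
    { vertex = at w
    ; edge   = at-edge w
    ; closed = trans (at-end w) (sym (at-start w))
    }

  module _ {k} (C : Cycle G k) where
    private
      k>0 : 0 < k
      k>0 = ≤-trans (s≤s z≤n) (k≥3 C)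
      instance
        k≢0 : NonZero k
        k≢0 = >-nonZero k>0

    cyclic-index : ℕ → Fin k
    cyclic-index i = i mod k

    private
      toℕ-cyclic-index : ∀ i → toℕ (cyclic-index i) ≡ i % k
      toℕ-cyclic-index i = toℕ-fromℕ< (m%n<n i k)

      cyclic-index-k≡0 : toℕ (cyclic-index k) ≡ 0
      cyclic-index-k≡0 = trans (toℕ-cyclic-index k) (n%n≡0 k)

      cyclic-index-< : ∀ {i} → i < k → toℕ (cyclic-index i) ≡ i
      cyclic-index-< {i} i<k = trans (toℕ-cyclic-index i) (m<n⇒m%n≡m i<k)

      edge′ : ∀ {i} → i < k → Adj G (vert C (cyclic-index i)) (vert C (cyclic-index (suc i)))
      edge′ {i} i<k with suc i <? k
      ... | yes 1+i<k = adj C _ _ (trans (cyclic-index-< 1+i<k) (cong suc (sym (cyclic-index-< i<k))))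
      ... | no  1+i≮k = wrap C _ _ (trans (cong suc (cyclic-index-< i<k)) 1+i≡k)
                          (trans (cong (toℕ ∘ cyclic-index) 1+i≡k) cyclic-index-k≡0)
        where
        1+i≡k : suc i ≡ k
        1+i≡k = ≤-antisym i<k (≮⇒≥ 1+i≮k)

    Cycle⇒ClosedWalk : ClosedWalk k
    Cycle⇒ClosedWalk = record
      { vertex = vert C ∘ cyclic-index
      ; edge   = edge′
      ; closed = cong (vert C) (toℕ-injective (trans cyclic-index-k≡0 (sym (cyclic-index-< k>0))))
      }

  odd-closed-walk-length≥3 : ∀ {L} → ClosedWalk L → Odd L → 3 ≤ L
  odd-closed-walk-length≥3 W (zero  , refl) =
    contradiction (subst (Adj G (vertex W 0)) (closed W) (edge W (s≤s z≤n))) (irrefl G)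
  odd-closed-walk-length≥3 W (suc m , refl) = +-monoˡ-≤ 1 (*-monoʳ-≤ 2 (s≤s (z≤n {m})))

  _⊆ᵛ_ : ∀ {L′ L} → ClosedWalk L′ → ClosedWalk L → Set
  W′ ⊆ᵛ W = ∀ k → ∃ λ k′ → vertex W′ k ≡ vertex W k′

  RepeatsVertex : ∀ {L} → ClosedWalk L → Set
  RepeatsVertex {L} W = ∃ λ j → j < L × ∃ λ i → i < j × vertex W i ≡ vertex W j

  repeatsVertex? : ∀ {L} (W : ClosedWalk L) → Dec (RepeatsVertex W)
  repeatsVertex? {L} W = anyUpTo? (λ j → anyUpTo? (λ i → vertex W i ≟ᶠ vertex W j) j) L

  ClosedWalk⇒Cycle : ∀ {L} (W : ClosedWalk L) → 3 ≤ L → ¬ RepeatsVertex W → Cycle G L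
  ClosedWalk⇒Cycle {L} W L≥3 distinct = record
    { k≥3  = L≥3
    ; vert = vertex W ∘ toℕ
    ; inj  = injective
    ; adj  = λ i j j≡1+i → subst (Adj G _ ∘ vertex W) (sym j≡1+i)
               (edge W (<⇒≤ (subst (_< L) j≡1+i (toℕ<n j))))
    ; wrap = λ i j 1+i≡L j≡0 →
               subst (Adj G _)
                 (trans (cong (vertex W) 1+i≡L) (trans (closed W) (cong (vertex W) (sym j≡0))))
                 (edge W (subst (_≤ L) (sym 1+i≡L) ≤-refl))
    }
    where
    injective : ∀ {a b} → vertex W (toℕ a) ≡ vertex W (toℕ b) → a ≡ b
    injective {a} {b} eq with <-cmp (toℕ a) (toℕ b)
    ... | tri< a<b _ _ = contradiction (toℕ b , toℕ<n b , toℕ a , a<b , eq) distinct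
    ... | tri≈ _ a≡b _ = toℕ-injective a≡b
    ... | tri> _ _ b<a = contradiction (toℕ a , toℕ<n a , toℕ b , b<a , sym eq) distinct

  module Split {L} (W : ClosedWalk L) {i j} (i<j : i < j) (j<L : j < L)
               (repeat : vertex W i ≡ vertex W j) where

    p : ℕ
    p = j ∸ i

    i+p≡j : i + p ≡ j
    i+p≡j = m+[n∸m]≡n (<⇒≤ i<j)

    p≤L : p ≤ L
    p≤L = ≤-trans (m∸n≤m j i) (<⇒≤ j<L)

    loop : ClosedWalk p
    loop = record
      { vertex = λ k → vertex W (i + k)
      ; edge   = λ {k} k<p → subst (Adj G (vertex W (i + k)) ∘ vertex W) (sym (+-suc i k))
                   (edge W (<-trans (<-≤-trans (+-monoʳ-< i k<p) (≤-reflexive i+p≡j)) j<L))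
      ; closed = trans (cong (vertex W) i+p≡j)
                   (trans (sym repeat) (cong (vertex W) (sym (+-identityʳ i))))
      }

    bypass : ℕ → ℕ
    bypass k with k ≤? i
    ... | yes _ = k
    ... | no  _ = k + p

    bypass-≤ : ∀ {k} → k ≤ i → bypass k ≡ k
    bypass-≤ {k} k≤i with k ≤? i
    ... | yes _   = refl
    ... | no  k≰i = contradiction k≤i k≰i

    bypass-> : ∀ {k} → i < k → bypass k ≡ k + p
    bypass-> {k} i<k with k ≤? i
    ... | yes k≤i = contradiction i<k (≤⇒≯ k≤i)
    ... | no  _   = refl

    vertex-bypass-≥ : ∀ {k} → i ≤ k → vertex W (bypass k) ≡ vertex W (k + p)
    vertex-bypass-≥ i≤k with m≤n⇒m<n∨m≡n i≤k
    ... | inj₁ i<k  = cong (vertex W) (bypass-> i<k)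
    ... | inj₂ refl =
      trans (cong (vertex W) (bypass-≤ ≤-refl)) (trans repeat (cong (vertex W) (sym i+p≡j)))

    l : ℕ
    l = L ∸ p

    i<l : i < l
    i<l = m+n≤o⇒m≤o∸n (suc i) (subst (_< L) (sym i+p≡j) j<L)

    shortcut : ClosedWalk l
    shortcut = record
      { vertex = vertex W ∘ bypass
      ; edge   = edge′
      ; closed = begin
          vertex W (bypass l) ≡⟨ cong (vertex W) (bypass-> i<l) ⟩
          vertex W (l + p)    ≡⟨ cong (vertex W) (m∸n+n≡m p≤L) ⟩
          vertex W L          ≡⟨ closed W ⟩
          vertex W 0          ≡⟨ cong (vertex W) (bypass-≤ z≤n) ⟨
          vertex W (bypass 0) ∎
      }
      where
      open ≡-Reasoning
      edge′ : ∀ {k} → k < l → Adj G (vertex W (bypass k)) (vertex W (bypass (suc k)))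
      edge′ {k} k<l with i ≤? k
      ... | yes i≤k rewrite bypass-> (s≤s i≤k) =
        subst (λ u → Adj G u (vertex W (suc k + p))) (sym (vertex-bypass-≥ i≤k))
          (edge W (<-≤-trans (+-monoˡ-< p k<l) (≤-reflexive (m∸n+n≡m p≤L))))
      ... | no  i≰k rewrite bypass-≤ (<⇒≤ (≰⇒> i≰k)) | bypass-≤ (≰⇒> i≰k) =
        edge W (<-trans (≰⇒> i≰k) (<-trans i<j j<L))

    l<L : l < L
    l<L = ∸-monoʳ-< (m<n⇒0<n∸m i<j) p≤L

    p<L : p < L
    p<L = ≤-<-trans (m∸n≤m j i) j<L

    shorter-odd : Odd L → ∃ λ L′ → L′ < L × Σ (ClosedWalk L′) λ W′ → Odd L′ × W′ ⊆ᵛ W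
    shorter-odd o with Odd-+ p l (subst Odd (sym (m+[n∸m]≡n p≤L)) o)
    ... | inj₁ odd-p = p , p<L , loop , odd-p , λ k → i + k , refl
    ... | inj₂ odd-l = l , l<L , shortcut , odd-l , λ k → bypass k , refl

  -- A repeated vertex splits an odd closed walk into two shorter closed walks, one of them odd.
  odd-closed-walk⇒odd-cycle : ∀ {S : Fin n → Set} {L} (W : ClosedWalk L) → Odd L →
                              (∀ i → S (vertex W i)) → HasShortOddCycleIn G S L
  odd-closed-walk⇒odd-cycle {S} {L} = <-rec Goal extract L
    where
    Goal : ℕ → Set
    Goal L = (W : ClosedWalk L) → Odd L → (∀ i → S (vertex W i)) → HasShortOddCycleIn G S L
    extract : ∀ L → (∀ {L′} → L′ < L → Goal L′) → Goal L
    extract L shorter W o inS with repeatsVertex? W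
    ... | no distinct =
      L , ClosedWalk⇒Cycle W (odd-closed-walk-length≥3 W o) distinct , o , ≤-refl , inS ∘ toℕ
    ... | yes (j , j<L , i , i<j , repeat) with Split.shorter-odd W i<j j<L repeat o
    ... | L′ , L′<L , W′ , o′ , W′⊆W =
      HasShortOddCycleIn-mono {S = S} {T = S} id (<⇒≤ L′<L) (shorter L′<L W′ o′ inS′)
      where
      inS′ : ∀ k → S (vertex W′ k)
      inS′ k with W′⊆W k
      ... | k′ , eq = subst S (sym eq) (inS k′)

  equidistant-edge⇒odd-cycle : ∀ {v x y d} → Adj G x y → Walk G v x d → Walk G v y d →
                               HasShortOddCycleIn G (InBall G v d) (2 * d + 1)
  equidistant-edge⇒odd-cycle {v} {x} {d = d} a p q =
    HasShortOddCycleIn-mono {S = InBall G v d} id (≤-reflexive length)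
      (odd-closed-walk⇒odd-cycle {S = InBall G v d}
        (Walk⇒ClosedWalk W) (d , length) (All-at W inBall))
    where
    W : Walk G v v (d + suc d)
    W = p ++ step a (reverse q)
    length : d + suc d ≡ 2 * d + 1
    length = solve (d ∷ [])
    inBall : All (InBall G v d) W
    inBall = All-++ p _ (All-DistLe p) ((d , ≤-refl , p) , All-reverse q (All-DistLe q))

  record LevelEdge (v : Fin n) (r : ℕ) {L} (W : ClosedWalk L) : Set where
    field
      index    : ℕ
      index<L  : index < L
      level    : ℕ
      level≤r  : level ≤ r
      source   : DistEq G v (vertex W index) level
      target   : DistEq G v (vertex W (suc index)) level

  level-edge : ∀ {v r L} (W : ClosedWalk L) → Odd L → (∀ i → InBall G v r (vertex W i)) →
               LevelEdge v r W
  level-edge {v} {r} {L} W o inBall = conclude (lipschitz-odd-loop⇒level-step h o loop lipschitz)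
    where
    h : ℕ → ℕ
    h i = proj₁ (distance (inBall i))
    h≤r : ∀ i → h i ≤ r
    h≤r i = proj₁ (proj₂ (distance (inBall i)))
    dist : ∀ i → DistEq G v (vertex W i) (h i)
    dist i = proj₂ (proj₂ (distance (inBall i)))
    loop : h L ≡ h 0
    loop = DistEq-unique (subst (λ u → DistEq G v u (h L)) (closed W) (dist L)) (dist 0)
    lipschitz : ∀ {i} → i < L → h (suc i) ≤ suc (h i) × h i ≤ suc (h (suc i))
    lipschitz i<L = DistEq-edge (edge W i<L) (dist _) (dist _)
                  , DistEq-edge (Graph.sym G (edge W i<L)) (dist _) (dist _)
    conclude : (∃ λ i → i < L × h i ≡ h (suc i)) → LevelEdge v r W
    conclude (i , i<L , level) = record
      { index = i ; index<L = i<L ; level = h i ; level≤r = h≤r i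
      ; source = dist i ; target = subst (DistEq G v _) (sym level) (dist (suc i)) }

lemma9 : ∀ {n} (G : Graph n) (v : Fin n) (r : ℕ) → 1 ≤ r →
           ∀ {k} (C : Cycle G k) → Odd k → CycleIn (InBall G v r) C →
           HasShortOddCycleIn G (InBall G v r) (2 * r + 1)
           × (SphereCycleIndependent G v r C →
                HasShortOddCycleIn G (InBall G v (r ∸ 1)) (2 * r ∸ 1))
lemma9 G v (suc r) _ {k} C o inC =
  widen level≤r (2d+1≤ level≤r) ,
  λ independent → widen (level≤r-1 independent)
                    (≤-trans (2d+1≤ (level≤r-1 independent)) (≤-reflexive 2r+1≡2[1+r]∸1))
  where
  W : ClosedWalk G k
  W = Cycle⇒ClosedWalk G C
  open LevelEdge (level-edge G W o (inC ∘ cyclic-index G C))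
  xy : Adj G (ClosedWalk.vertex W index) (ClosedWalk.vertex W (suc index))
  xy = ClosedWalk.edge W index<L
  widen : ∀ {s L} → level ≤ s → 2 * level + 1 ≤ L → HasShortOddCycleIn G (InBall G v s) L
  widen level≤s bound = HasShortOddCycleIn-mono G {S = InBall G v level} (InBall-mono G level≤s) bound
    (equidistant-edge⇒odd-cycle G xy (DistEq⇒Walk G source) (DistEq⇒Walk G target))
  level≤r-1 : SphereCycleIndependent G v (suc r) C → level ≤ r
  level≤r-1 independent = ≤-pred (≤∧≢⇒< level≤r λ level≡1+r →
    independent (cyclic-index G C index) (cyclic-index G C (suc index))
      (subst (DistEq G v _) level≡1+r source) (subst (DistEq G v _) level≡1+r target) xy)
  2d+1≤ : ∀ {d s} → d ≤ s → 2 * d + 1 ≤ 2 * s + 1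
  2d+1≤ d≤s = +-monoˡ-≤ 1 (*-monoʳ-≤ 2 d≤s)
  2r+1≡2[1+r]∸1 : 2 * r + 1 ≡ 2 * suc r ∸ 1
  2r+1≡2[1+r]∸1 = trans (+-comm _ 1) (sym (+-suc r (r + 0)))
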